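{- Let $n\geqslant 4$, let $S$ be a square-free subset of $\mathbb{Z}_n$ with $n=p|S|$ for some prime $p$, and suppose the Cayley sum graph $\Gamma=\mathrm{CS}(\mathbb{Z}_n,S)$ is connected. Let $H=\{g\in\mathbb{Z}_n: S+g=S\}$ be the subgroup of periods of $S$, and put $k=|S|/|H|$. Then $\Gamma$ has a total perfect code if and only if $p=2$ and $s\not\equiv s'\pmod{k}$ for all $s,s'\in S$ with $H+s\neq H+s'$. In this case, the total perfect codes of $\Gamma$ have the general form $\{h_1+i,\ h_2+i+k\}$, where $h_1,h_2\in H$ and $0\leqslant i\leqslant k$.
   Context: For an abelian group $G$ and $S\subseteq G$, the Cayley sum graph $\mathrm{CS}(G,S)$ has vertex set $G$, two vertices $g,h$ being adjacent iff $g+h\in S$ and $g\neq h$. A total perfect code of a graph is a set $C$ of vertices such that every vertex has exactly one neighbor in $C$. An element $x\in G$ is a square if $x=y+y$ for some $y\in G$; $S$ is square-free if it contains no squares. For $X\subseteq G$ and a subgroup $H$, $X+g=\{x+g:x\in X\}$ and $X/H=\{H+x:x\in X\}$. Elements of $\mathbb{Z}_n$ are identified with integers $0,\dots,n-1$. -}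

module Defs where

open import Data.Nat using (ℕ; zero; suc; _+_; _*_; ∣_-_∣)
open import Data.Nat.DivMod using (_mod_)
open import Data.Nat.Divisibility using (_∣_)
open import Data.Fin using (Fin; toℕ)
open import Data.Fin.Subset using (Subset; _∈_; ∣_∣)
open import Data.Product using (Σ; ∃; _×_)
open import Data.Sum using (_⊎_)
open import Relation.Nullary using (¬_)
open import Relation.Binary.PropositionalEquality using (_≡_)
open import Relation.Binary.Construct.Closure.ReflexiveTransitive using (Star)
open import Function.Bundles using (_⇔_)

_⊕_ : ∀ {n} → Fin n → Fin n → Fin n
_⊕_ {suc m} a b = (toℕ a + toℕ b) mod (suc m)

_⊕ℕ_ : ∀ {n} → Fin n → ℕ → Fin n
_⊕ℕ_ {suc m} a i = (toℕ a + i) mod (suc m)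

IsSquare : ∀ {n} → Fin n → Set
IsSquare x = ∃ λ y → x ≡ y ⊕ y

SquareFree : ∀ {n} → Subset n → Set
SquareFree {n} S = (x : Fin n) → x ∈ S → ¬ IsSquare x

Adj : ∀ {n} → Subset n → Fin n → Fin n → Set
Adj S g h = (g ⊕ h) ∈ S × ¬ (g ≡ h)

Connected : ∀ {n} → Subset n → Set
Connected {n} S = (g h : Fin n) → Star (Adj S) g h

InTranslate : ∀ {n} → Subset n → Fin n → Fin n → Set
InTranslate X g y = ∃ λ x → x ∈ X × y ≡ x ⊕ g

IsPeriod : ∀ {n} → Subset n → Fin n → Set
IsPeriod {n} S g = (y : Fin n) → (InTranslate S g y ⇔ y ∈ S)

SameCoset : ∀ {n} → Subset n → Fin n → Fin n → Set
SameCoset {n} H s s' = (y : Fin n) → (InTranslate H s y ⇔ InTranslate H s' y)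

IsTPC : ∀ {n} → Subset n → Subset n → Set
IsTPC {n} S C = (g : Fin n) → ∃ λ c → c ∈ C × Adj S g c
                 × ((c' : Fin n) → c' ∈ C → Adj S g c' → c' ≡ c)

HasTPC : ∀ {n} → Subset n → Set
HasTPC {n} S = Σ (Subset n) (IsTPC S)

-- s ≢ s' (mod k) for all s, s' ∈ S with H + s ≠ H + s'
-- (congruence of the representatives 0,…,n-1 modulo k)
CosetCondition : ∀ {n} → Subset n → Subset n → ℕ → Set
CosetCondition {n} S H k = (s s' : Fin n) → s ∈ S → s' ∈ S → ¬ SameCoset H s s'
                            → ¬ (k ∣ ∣ toℕ s - toℕ s' ∣)

GeneralForm : ∀ {n} → Subset n → ℕ → Subset n → Set
GeneralForm {n} H k C = ∃ λ h₁ → ∃ λ h₂ → ∃ λ i → h₁ ∈ H × h₂ ∈ H × i Data.Nat.≤ k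
  × ((x : Fin n) → (x ∈ C ⇔ (x ≡ h₁ ⊕ℕ i ⊎ x ≡ h₂ ⊕ℕ (i + k))))

-- Squares of ℤ_n are the even residues when n is even and all residues when n is odd, so a
-- square-free S forces n even and S ⊆ odd residues. A total perfect code C then serves each even
-- vertex by exactly one odd element of C, and each odd c ∈ C serves exactly the |S| even vertices
-- of S − c; counting gives n/2 = K |S| with K the number of odd elements of C, i.e. p = 2K, so p = 2.
-- Then |S| = n/2 makes S the set of all odd residues: its periods are the even residues, so H is
-- the even subgroup and k = 1, and the total perfect codes are exactly the sets with one element
-- of each parity, which is the general form {h₁ + i, h₂ + i + 1}.
{-# OPTIONS --safe #-}
module Submission where

open import Defs
open import Data.Nat using (ℕ; suc; _+_; _*_; _∸_; _≤_; _<_; _%_; z≤n; s≤s; NonZero; ≢-nonZero)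
open import Data.Nat.Properties
open import Data.Nat.DivMod
  using (_mod_; %-distribˡ-+; m%n%n≡m%n; [m+n]%n≡m%n; [m+kn]%n≡m%n; m<n⇒m%n≡m; m∣n⇒o%n%m≡o%m)
open import Data.Nat.Divisibility using (_∣_; divides; m%n≡0⇒n∣m)
open import Data.Nat.Primality using (Prime; prime⇒irreducible)
open import Data.Fin using (Fin; toℕ; punchIn) renaming (zero to fzero; suc to fsuc)
open import Data.Fin.Patterns using (0F; 1F)
open import Data.Fin.Properties using (toℕ-injective; toℕ-fromℕ<; toℕ<n; punchInᵢ≢i)
open import Data.Fin.Permutation using (Permutation′; permutation)
open import Data.Fin.Subset using (Subset; _∈_; _∉_; ∣_∣; inside; outside; ⊤; ⁅_⁆; _∪_; Nonempty)
open import Data.Fin.Subset.Properties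
  using (_∈?_; ∈⊤; ∣⊤∣≡n; ∣⊥∣≡0; Empty-unique; nonempty?; x∈⁅y⁆⇔x≡y; ∪⇔⊎)
open import Data.Vec.Base using (_∷_; []; here; there)
open import Data.Vec.Functional using (removeAt)
open import Data.Product using (Σ; Σ-syntax; _×_; _,_; proj₁; proj₂)
open import Data.Sum using (_⊎_; inj₁; inj₂; swap; map)
open import Function using (_∘_)
open import Function.Bundles using (_⇔_; mk⇔; Equivalence)
open import Function.Properties.Equivalence using () renaming (trans to ⇔-trans; sym to ⇔-sym)
open import Relation.Nullary using (yes; no; contradiction)
open import Relation.Binary.PropositionalEquality
open import Algebra.Properties.Semiring.Sum +-*-semiring
  using ( sum; sum-cong-≗; sum-replicate-zero; sum-remove; ∑-comm; ∑-distrib-+; ∑-permute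
        ; *-distribˡ-sum; *-distribʳ-sum)
open import Algebra.Properties.CommutativeSemigroup *-commutativeSemigroup using (x∙yz≈y∙xz)

open Equivalence using (to; from)

[m%d+n]%d≡[m+n]%d : ∀ m n d .{{_ : NonZero d}} → (m % d + n) % d ≡ (m + n) % d
[m%d+n]%d≡[m+n]%d m n d = begin
  (m % d + n) % d           ≡⟨ %-distribˡ-+ (m % d) n d ⟩
  (m % d % d + n % d) % d   ≡⟨ cong (λ r → (r + n % d) % d) (m%n%n≡m%n m d) ⟩
  (m % d + n % d) % d       ≡⟨ %-distribˡ-+ m n d ⟨
  (m + n) % d               ∎
  where open ≡-Reasoning

[m+n%d]%d≡[m+n]%d : ∀ m n d .{{_ : NonZero d}} → (m + n % d) % d ≡ (m + n) % d
[m+n%d]%d≡[m+n]%d m n d = begin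
  (m + n % d) % d   ≡⟨ cong (_% d) (+-comm m (n % d)) ⟩
  (n % d + m) % d   ≡⟨ [m%d+n]%d≡[m+n]%d n m d ⟩
  (n + m) % d       ≡⟨ cong (_% d) (+-comm n m) ⟩
  (m + n) % d       ∎
  where open ≡-Reasoning

toℕ-mod : ∀ i n .{{_ : NonZero n}} → toℕ (i mod n) ≡ i % n
toℕ-mod i n = toℕ-fromℕ< _

⊕₂-cancelʳ : (a b : Fin 2) → (a ⊕ b) ⊕ b ≡ a
⊕₂-cancelʳ 0F 0F = refl
⊕₂-cancelʳ 0F 1F = refl
⊕₂-cancelʳ 1F 0F = refl
⊕₂-cancelʳ 1F 1F = refl

⊕₂-identityˡ : (b : Fin 2) → 0F ⊕ b ≡ b
⊕₂-identityˡ 0F = refl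
⊕₂-identityˡ 1F = refl

⊕₂≡1⇔ : (a b : Fin 2) → a ⊕ b ≡ 1F ⇔ b ≡ a ⊕ 1F
⊕₂≡1⇔ 0F 0F = mk⇔ (λ ()) (λ ())
⊕₂≡1⇔ 0F 1F = mk⇔ (λ _ → refl) (λ _ → refl)
⊕₂≡1⇔ 1F 0F = mk⇔ (λ _ → refl) (λ _ → refl)
⊕₂≡1⇔ 1F 1F = mk⇔ (λ ()) (λ ())

b≢b⊕1 : (b : Fin 2) → b ≢ b ⊕ 1F
b≢b⊕1 0F ()
b≢b⊕1 1F ()

1≡1⊕b⇒b≡0 : (b : Fin 2) → 1F ≡ 1F ⊕ b → b ≡ 0F
1≡1⊕b⇒b≡0 0F _ = refl
1≡1⊕b⇒b≡0 1F ()

toℕ[b⊕1]+toℕb≡1 : (b : Fin 2) → toℕ (b ⊕ 1F) + toℕ b ≡ 1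
toℕ[b⊕1]+toℕb≡1 0F = refl
toℕ[b⊕1]+toℕb≡1 1F = refl

even-prime≡2 : ∀ {p} → Prime p → 2 ∣ p → p ≡ 2
even-prime≡2 p-prime 2∣p with prime⇒irreducible p-prime 2∣p
... | inj₁ ()
... | inj₂ 2≡p = sym 2≡p

indicator : ∀ {n} → Subset n → Fin n → ℕ
indicator (_ ∷ p) (fsuc x) = indicator p x
indicator (inside ∷ _) fzero = 1
indicator (outside ∷ _) fzero = 0

∣p∣≡sum-indicator : ∀ {n} (p : Subset n) → ∣ p ∣ ≡ sum (indicator p)
∣p∣≡sum-indicator [] = refl
∣p∣≡sum-indicator (inside ∷ p) = cong suc (∣p∣≡sum-indicator p)
∣p∣≡sum-indicator (outside ∷ p) = ∣p∣≡sum-indicator p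

indicator-∈ : ∀ {n} {p : Subset n} {x} → x ∈ p → indicator p x ≡ 1
indicator-∈ here = refl
indicator-∈ (there x∈p) = indicator-∈ x∈p

indicator-∉ : ∀ {n} {p : Subset n} {x} → x ∉ p → indicator p x ≡ 0
indicator-∉ {p = inside ∷ p} {fzero} x∉p = contradiction here x∉p
indicator-∉ {p = outside ∷ p} {fzero} _ = refl
indicator-∉ {p = _ ∷ p} {fsuc x} x∉p = indicator-∉ (x∉p ∘ there)

∣p∣≢0⇒nonempty : ∀ {n} (p : Subset n) → ∣ p ∣ ≢ 0 → Nonempty p
∣p∣≢0⇒nonempty {n} p ∣p∣≢0 with nonempty? p
... | yes ne = ne
... | no empty = contradiction (trans (cong ∣_∣ (Empty-unique empty)) (∣⊥∣≡0 n)) ∣p∣≢0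

sum-zero : ∀ {n} (f : Fin n → ℕ) → (∀ i → f i ≡ 0) → sum f ≡ 0
sum-zero {n} f f≡0 = trans (sum-cong-≗ f≡0) (sum-replicate-zero n)

sum-one : ∀ n → sum {n} (λ _ → 1) ≡ n
sum-one n = begin
  sum {n} (λ _ → 1)        ≡⟨ sum-cong-≗ {n} (λ x → indicator-∈ (∈⊤ {x = x})) ⟨
  sum (indicator (⊤ {n}))  ≡⟨ ∣p∣≡sum-indicator (⊤ {n}) ⟨
  ∣ ⊤ {n} ∣                ≡⟨ ∣⊤∣≡n n ⟩
  n                        ∎
  where open ≡-Reasoning

f≤sum : ∀ {n} (f : Fin n → ℕ) i → f i ≤ sum f
f≤sum {suc n} f i = subst (f i ≤_) (sym (sum-remove {i = i} f)) (m≤m+n (f i) _)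

sum-concentrated : ∀ {n} (f : Fin (suc n) → ℕ) c → (∀ i → i ≢ c → f i ≡ 0) → sum f ≡ f c
sum-concentrated f c off = begin
  sum f                     ≡⟨ sum-remove {i = c} f ⟩
  f c + sum (removeAt f c)  ≡⟨ cong (f c +_) (sum-zero _ (λ j → off (punchIn c j) (punchInᵢ≢i c j))) ⟩
  f c + 0                   ≡⟨ +-identityʳ (f c) ⟩
  f c                       ∎
  where open ≡-Reasoning

sum≤∣p∣⇒support⊆p : ∀ {n} (p : Subset n) (f : Fin n → ℕ) → (∀ x → indicator p x ≤ f x)
                  → sum f ≤ ∣ p ∣ → ∀ x → 0 < f x → x ∈ p
sum≤∣p∣⇒support⊆p p f χ≤f Σf≤∣p∣ x 0<fx with x ∈? p
... | yes x∈p = x∈p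
... | no x∉p = contradiction Σf≤∣p∣ (<⇒≱ (begin-strict
  ∣ p ∣                          <⟨ m<m+n ∣ p ∣ 0<fx ⟩
  ∣ p ∣ + f x                    ≡⟨ cong (λ t → ∣ p ∣ + (f x ∸ t)) (indicator-∉ x∉p) ⟨
  ∣ p ∣ + (f x ∸ indicator p x)  ≤⟨ +-monoʳ-≤ ∣ p ∣ (f≤sum g x) ⟩
  ∣ p ∣ + sum g                  ≡⟨ cong (_+ sum g) (∣p∣≡sum-indicator p) ⟩
  sum (indicator p) + sum g      ≡⟨ ∑-distrib-+ (indicator p) g ⟨
  sum (λ y → indicator p y + g y) ≡⟨ sum-cong-≗ (λ y → m+[n∸m]≡n (χ≤f y)) ⟩
  sum f                          ∎))
  where
  open ≤-Reasoning
  g : Fin _ → ℕ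
  g y = f y ∸ indicator p y

module Cyclic (m : ℕ) where

  N : ℕ
  N = suc m

  factor≢0 : ∀ {a b} → N ≡ a * b → b ≢ 0
  factor≢0 {a} N≡ab refl = 1+n≢0 (trans N≡ab (*-zeroʳ a))

  toℕ-⊕ : (a b : Fin N) → toℕ (a ⊕ b) ≡ (toℕ a + toℕ b) % N
  toℕ-⊕ a b = toℕ-mod (toℕ a + toℕ b) N

  ⊕ℕ-as-⊕ : (a : Fin N) (i : ℕ) → a ⊕ℕ i ≡ a ⊕ (i mod N)
  ⊕ℕ-as-⊕ a i = toℕ-injective (begin
    toℕ (a ⊕ℕ i)              ≡⟨ toℕ-mod (toℕ a + i) N ⟩
    (toℕ a + i) % N           ≡⟨ [m+n%d]%d≡[m+n]%d (toℕ a) i N ⟨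
    (toℕ a + i % N) % N       ≡⟨ cong (λ t → (toℕ a + t) % N) (toℕ-mod i N) ⟨
    (toℕ a + toℕ (i mod N)) % N ≡⟨ toℕ-⊕ a _ ⟨
    toℕ (a ⊕ (i mod N))       ∎)
    where open ≡-Reasoning

  ⊕ℕ-identityʳ : (a : Fin N) → a ⊕ℕ 0 ≡ a
  ⊕ℕ-identityʳ a = toℕ-injective (begin
    toℕ (a ⊕ℕ 0)     ≡⟨ toℕ-mod (toℕ a + 0) N ⟩
    (toℕ a + 0) % N  ≡⟨ cong (_% N) (+-identityʳ (toℕ a)) ⟩
    toℕ a % N        ≡⟨ m<n⇒m%n≡m (toℕ<n a) ⟩
    toℕ a            ∎)
    where open ≡-Reasoning

  _⊖_ : Fin N → Fin N → Fin N
  a ⊖ b = a ⊕ℕ (N ∸ toℕ b)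

  private
    %N-of-lift : (a : Fin N) (x : ℕ) → x ≡ toℕ a + N → x % N ≡ toℕ a
    %N-of-lift a x refl = trans ([m+n]%n≡m%n (toℕ a) N) (m<n⇒m%n≡m (toℕ<n a))

  ⊖-⊕-cancel : (a b : Fin N) → (a ⊖ b) ⊕ b ≡ a
  ⊖-⊕-cancel a b = toℕ-injective (begin
    toℕ ((a ⊖ b) ⊕ b)                          ≡⟨ toℕ-⊕ (a ⊖ b) b ⟩
    (toℕ (a ⊖ b) + toℕ b) % N                  ≡⟨ cong (λ t → (t + toℕ b) % N) (toℕ-mod (toℕ a + b′) N) ⟩
    ((toℕ a + b′) % N + toℕ b) % N             ≡⟨ [m%d+n]%d≡[m+n]%d (toℕ a + b′) (toℕ b) N ⟩
    (toℕ a + b′ + toℕ b) % N                   ≡⟨ %N-of-lift a _ lift ⟩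
    toℕ a                                      ∎)
    where
    open ≡-Reasoning
    b′ : ℕ
    b′ = N ∸ toℕ b
    lift : toℕ a + b′ + toℕ b ≡ toℕ a + N
    lift = trans (+-assoc (toℕ a) _ _) (cong (toℕ a +_) (m∸n+n≡m (<⇒≤ (toℕ<n b))))

  ⊕-⊖-cancel : (a b : Fin N) → (a ⊕ b) ⊖ b ≡ a
  ⊕-⊖-cancel a b = toℕ-injective (begin
    toℕ ((a ⊕ b) ⊖ b)                 ≡⟨ toℕ-mod (toℕ (a ⊕ b) + b′) N ⟩
    (toℕ (a ⊕ b) + b′) % N            ≡⟨ cong (λ t → (t + b′) % N) (toℕ-⊕ a b) ⟩
    ((toℕ a + toℕ b) % N + b′) % N    ≡⟨ [m%d+n]%d≡[m+n]%d (toℕ a + toℕ b) b′ N ⟩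
    (toℕ a + toℕ b + b′) % N          ≡⟨ %N-of-lift a _ lift ⟩
    toℕ a                             ∎)
    where
    open ≡-Reasoning
    b′ : ℕ
    b′ = N ∸ toℕ b
    lift : toℕ a + toℕ b + b′ ≡ toℕ a + N
    lift = trans (+-assoc (toℕ a) _ _) (cong (toℕ a +_) (m+[n∸m]≡n (<⇒≤ (toℕ<n b))))

  translation : Fin N → Permutation′ N
  translation c = permutation (_⊕ c) (_⊖ c) (λ y → ⊖-⊕-cancel y c) (λ x → ⊕-⊖-cancel x c)

  sum-translate : (f : Fin N → ℕ) (c : Fin N) → sum (λ g → f (g ⊕ c)) ≡ sum f
  sum-translate f c = sym (∑-permute f (translation c))

  sum-weighted-translates : (w : Fin N → ℕ) (S : Subset N)
    → sum (λ g → sum (λ c → w c * indicator S (g ⊕ c))) ≡ sum w * ∣ S ∣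
  sum-weighted-translates w S = begin
    sum (λ g → sum (λ c → w c * χS g c)) ≡⟨ ∑-comm (λ g c → w c * χS g c) ⟩
    sum (λ c → sum (λ g → w c * χS g c)) ≡⟨ sum-cong-≗ (λ c → *-distribˡ-sum (w c) (λ g → χS g c)) ⟨
    sum (λ c → w c * sum (λ g → χS g c)) ≡⟨ sum-cong-≗ (λ c → cong (w c *_) (translate-S c)) ⟩
    sum (λ c → w c * ∣ S ∣)              ≡⟨ *-distribʳ-sum ∣ S ∣ w ⟨
    sum w * ∣ S ∣                        ∎
    where
    open ≡-Reasoning
    χS : Fin N → Fin N → ℕ
    χS g c = indicator S (g ⊕ c)
    translate-S : ∀ c → sum (λ g → χS g c) ≡ ∣ S ∣
    translate-S c = trans (sum-translate (indicator S) c) (sym (∣p∣≡sum-indicator S))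

  -- The square root is q mod N, where x + jN = 2q.
  isSquare-if-even-lift : (x : Fin N) (j : ℕ) → (toℕ x + j * N) % 2 ≡ 0 → IsSquare x
  isSquare-if-even-lift x j even with m%n≡0⇒n∣m _ 2 even
  ... | divides q lift≡q*2 = q mod N , toℕ-injective (sym (begin
    toℕ ((q mod N) ⊕ (q mod N))          ≡⟨ toℕ-⊕ (q mod N) (q mod N) ⟩
    (toℕ (q mod N) + toℕ (q mod N)) % N  ≡⟨ cong (λ t → (t + t) % N) (toℕ-mod q N) ⟩
    (q % N + q % N) % N                  ≡⟨ [m%d+n]%d≡[m+n]%d q (q % N) N ⟩
    (q + q % N) % N                      ≡⟨ [m+n%d]%d≡[m+n]%d q q N ⟩
    (q + q) % N                          ≡⟨ cong (_% N) q+q≡lift ⟩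
    (toℕ x + j * N) % N                  ≡⟨ [m+kn]%n≡m%n (toℕ x) j N ⟩
    toℕ x % N                            ≡⟨ m<n⇒m%n≡m (toℕ<n x) ⟩
    toℕ x                                ∎))
    where
    open ≡-Reasoning
    q+q≡lift : q + q ≡ toℕ x + j * N
    q+q≡lift = trans (cong (q +_) (sym (+-identityʳ q))) (sym (trans lift≡q*2 (*-comm q 2)))

  squareFree⇒irreflexive : ∀ {S : Subset N} → SquareFree S → ∀ {g c} → (g ⊕ c) ∈ S → g ≢ c
  squareFree⇒irreflexive sf {g} g⊕g∈S refl = sf (g ⊕ g) g⊕g∈S (g , refl)

  isTPC⇒neighbour-count : ∀ {S C : Subset N} → SquareFree S → IsTPC S C
    → ∀ g → sum (λ c → indicator C c * indicator S (g ⊕ c)) ≡ 1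
  isTPC⇒neighbour-count {S} {C} sf tpc g with tpc g
  ... | c₀ , c₀∈C , (g⊕c₀∈S , _) , unique = begin
    sum f   ≡⟨ sum-concentrated f c₀ off ⟩
    f c₀    ≡⟨ cong₂ _*_ (indicator-∈ c₀∈C) (indicator-∈ g⊕c₀∈S) ⟩
    1       ∎
    where
    open ≡-Reasoning
    f : Fin N → ℕ
    f c = indicator C c * indicator S (g ⊕ c)
    off : ∀ c → c ≢ c₀ → f c ≡ 0
    off c c≢c₀ with c ∈? C | (g ⊕ c) ∈? S
    ... | no c∉C | _ = cong (_* indicator S (g ⊕ c)) (indicator-∉ c∉C)
    ... | yes _ | no g⊕c∉S rewrite indicator-∉ g⊕c∉S = *-zeroʳ (indicator C c)
    ... | yes c∈C | yes g⊕c∈S =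
      contradiction (unique c c∈C (g⊕c∈S , squareFree⇒irreflexive sf g⊕c∈S)) c≢c₀

  parity : Fin N → Fin 2
  parity x = toℕ x mod 2

  toℕ-parity : (x : Fin N) → toℕ (parity x) ≡ toℕ x % 2
  toℕ-parity x = toℕ-mod (toℕ x) 2

  squareFree⇒odd : ∀ {S : Subset N} → SquareFree S → ∀ {x} → x ∈ S → parity x ≡ 1F
  squareFree⇒odd sf {x} x∈S with parity x in px
  ... | 1F = refl
  ... | 0F = contradiction (isSquare-if-even-lift x 0 x+0-even) (sf x x∈S)
    where
    x+0-even : (toℕ x + 0) % 2 ≡ 0
    x+0-even = trans (cong (_% 2) (+-identityʳ (toℕ x)))
                     (trans (sym (toℕ-parity x)) (cong toℕ px))

  -- For odd N every element is a square: x + N is even when x is odd.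
  squareFree⇒modulus-even : ∀ {S : Subset N} → SquareFree S → ∀ {x} → x ∈ S → 2 ∣ N
  squareFree⇒modulus-even sf {x} x∈S with N mod 2 in pN
  ... | 0F = m%n≡0⇒n∣m N 2 (trans (sym (toℕ-mod N 2)) (cong toℕ pN))
  ... | 1F = contradiction (isSquare-if-even-lift x 1 x+N-even) (sf x x∈S)
    where
    x+N-even : (toℕ x + 1 * N) % 2 ≡ 0
    x+N-even = begin
      (toℕ x + 1 * N) % 2                   ≡⟨ cong (λ t → (toℕ x + t) % 2) (*-identityˡ N) ⟩
      (toℕ x + N) % 2                       ≡⟨ %-distribˡ-+ (toℕ x) N 2 ⟩
      (toℕ x % 2 + N % 2) % 2               ≡⟨ cong₂ (λ a b → (a + b) % 2) (toℕ-parity x) (toℕ-mod N 2) ⟨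
      (toℕ (parity x) + toℕ (N mod 2)) % 2  ≡⟨ cong₂ (λ a b → (toℕ a + toℕ b) % 2) (squareFree⇒odd sf x∈S) pN ⟩
      0                                     ∎
      where open ≡-Reasoning

  module Even (2∣N : 2 ∣ N) where

    parity-mod : (i : ℕ) → parity (i mod N) ≡ i mod 2
    parity-mod i = toℕ-injective (begin
      toℕ (parity (i mod N))  ≡⟨ toℕ-parity (i mod N) ⟩
      toℕ (i mod N) % 2       ≡⟨ cong (_% 2) (toℕ-mod i N) ⟩
      i % N % 2               ≡⟨ m∣n⇒o%n%m≡o%m 2 N i 2∣N ⟩
      i % 2                   ≡⟨ toℕ-mod i 2 ⟨
      toℕ (i mod 2)           ∎)
      where open ≡-Reasoning

    parity-⊕ : (a b : Fin N) → parity (a ⊕ b) ≡ parity a ⊕ parity b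
    parity-⊕ a b = toℕ-injective (begin
      toℕ (parity (a ⊕ b))                        ≡⟨ toℕ-parity (a ⊕ b) ⟩
      toℕ (a ⊕ b) % 2                             ≡⟨ cong (_% 2) (toℕ-⊕ a b) ⟩
      (toℕ a + toℕ b) % N % 2                     ≡⟨ m∣n⇒o%n%m≡o%m 2 N (toℕ a + toℕ b) 2∣N ⟩
      (toℕ a + toℕ b) % 2                         ≡⟨ %-distribˡ-+ (toℕ a) (toℕ b) 2 ⟩
      (toℕ a % 2 + toℕ b % 2) % 2                 ≡⟨ cong₂ (λ s t → (s + t) % 2) (toℕ-parity a) (toℕ-parity b) ⟨
      (toℕ (parity a) + toℕ (parity b)) % 2       ≡⟨ toℕ-mod (toℕ (parity a) + toℕ (parity b)) 2 ⟨
      toℕ (parity a ⊕ parity b)                   ∎)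
      where open ≡-Reasoning

    parity-⊕ℕ : (a : Fin N) (i : ℕ) → parity (a ⊕ℕ i) ≡ parity a ⊕ (i mod 2)
    parity-⊕ℕ a i = begin
      parity (a ⊕ℕ i)              ≡⟨ cong parity (⊕ℕ-as-⊕ a i) ⟩
      parity (a ⊕ (i mod N))       ≡⟨ parity-⊕ a (i mod N) ⟩
      parity a ⊕ parity (i mod N)  ≡⟨ cong (parity a ⊕_) (parity-mod i) ⟩
      parity a ⊕ (i mod 2)         ∎
      where open ≡-Reasoning

    parity-⊖ : (a b : Fin N) → parity (a ⊖ b) ≡ parity a ⊕ parity b
    parity-⊖ a b = begin
      parity (a ⊖ b)                           ≡⟨ ⊕₂-cancelʳ (parity (a ⊖ b)) (parity b) ⟨
      (parity (a ⊖ b) ⊕ parity b) ⊕ parity b   ≡⟨ cong (_⊕ parity b) (parity-⊕ (a ⊖ b) b) ⟨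
      parity ((a ⊖ b) ⊕ b) ⊕ parity b          ≡⟨ cong (λ t → parity t ⊕ parity b) (⊖-⊕-cancel a b) ⟩
      parity a ⊕ parity b                      ∎
      where open ≡-Reasoning

    vertex : Fin 2 → Fin N
    vertex b = toℕ b mod N

    parity-vertex : (b : Fin 2) → parity (vertex b) ≡ b
    parity-vertex 0F = parity-mod 0
    parity-vertex 1F = parity-mod 1

    isOdd isEven : Fin N → ℕ
    isOdd x = toℕ (parity x)
    isEven x = toℕ (parity x ⊕ 1F)

    -- Translation by an odd element swaps the two parity classes.
    sum-isOdd≡sum-isEven : sum isOdd ≡ sum isEven
    sum-isOdd≡sum-isEven = trans (sum-cong-≗ isOdd≡isEven∘+1) (sum-translate isEven (vertex 1F))
      where
      isOdd≡isEven∘+1 : ∀ x → isOdd x ≡ isEven (x ⊕ vertex 1F)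
      isOdd≡isEven∘+1 x = cong toℕ (sym (begin
        parity (x ⊕ vertex 1F) ⊕ 1F            ≡⟨ cong (_⊕ 1F) (parity-⊕ x (vertex 1F)) ⟩
        (parity x ⊕ parity (vertex 1F)) ⊕ 1F   ≡⟨ cong (λ t → (parity x ⊕ t) ⊕ 1F) (parity-vertex 1F) ⟩
        (parity x ⊕ 1F) ⊕ 1F                   ≡⟨ ⊕₂-cancelʳ (parity x) 1F ⟩
        parity x                               ∎))
        where open ≡-Reasoning

    N≡2*sum-isEven : N ≡ 2 * sum isEven
    N≡2*sum-isEven = sym (begin
      2 * sum isEven                     ≡⟨ cong (sum isEven +_) (+-identityʳ (sum isEven)) ⟩
      sum isEven + sum isEven            ≡⟨ cong (sum isEven +_) sum-isOdd≡sum-isEven ⟨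
      sum isEven + sum isOdd             ≡⟨ ∑-distrib-+ isEven isOdd ⟨
      sum (λ x → isEven x + isOdd x)     ≡⟨ sum-cong-≗ (λ x → toℕ[b⊕1]+toℕb≡1 (parity x)) ⟩
      sum {N} (λ _ → 1)                  ≡⟨ sum-one N ⟩
      N                                  ∎)
      where open ≡-Reasoning

    N≡2*n⇒n≡sum-isEven : ∀ {n} → N ≡ 2 * n → n ≡ sum isEven
    N≡2*n⇒n≡sum-isEven {n} N≡2n =
      *-cancelˡ-≡ n (sum isEven) 2 (trans (sym N≡2n) N≡2*sum-isEven)

    module SubsetOfOdds {S : Subset N} (S-odd : ∀ {x} → x ∈ S → parity x ≡ 1F) where

      ∈S⇒opposite-parity : ∀ g c → (g ⊕ c) ∈ S → parity c ≡ parity g ⊕ 1F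
      ∈S⇒opposite-parity g c g⊕c∈S =
        to (⊕₂≡1⇔ (parity g) (parity c)) (trans (sym (parity-⊕ g c)) (S-odd g⊕c∈S))

      isOdd-weight : ∀ g c → isOdd c * indicator S (g ⊕ c) ≡ isEven g * indicator S (g ⊕ c)
      isOdd-weight g c with (g ⊕ c) ∈? S
      ... | yes g⊕c∈S = cong (λ b → toℕ b * indicator S (g ⊕ c)) (∈S⇒opposite-parity g c g⊕c∈S)
      ... | no g⊕c∉S rewrite indicator-∉ g⊕c∉S = trans (*-zeroʳ (isOdd c)) (sym (*-zeroʳ (isEven g)))

      -- Every even vertex has its unique C-neighbour among the odd elements of C.
      isTPC⇒sum-isEven : SquareFree S → ∀ {C} → IsTPC S C
        → sum isEven ≡ sum (λ c → indicator C c * isOdd c) * ∣ S ∣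
      isTPC⇒sum-isEven sf {C} tpc = begin
        sum isEven                                          ≡⟨ sum-cong-≗ (λ g → sym (count g)) ⟩
        sum (λ g → isEven g * sum (χCS g))                  ≡⟨ sum-cong-≗ (λ g → *-distribˡ-sum (isEven g) (χCS g)) ⟩
        sum (λ g → sum (λ c → isEven g * (χC c * χS g c)))  ≡⟨ sum-cong-≗ (λ g → sum-cong-≗ (regroup g)) ⟩
        sum (λ g → sum (λ c → χC c * isOdd c * χS g c))     ≡⟨ sum-weighted-translates (λ c → χC c * isOdd c) S ⟩
        sum (λ c → χC c * isOdd c) * ∣ S ∣                  ∎
        where
        open ≡-Reasoning
        χC : Fin N → ℕ
        χC = indicator C
        χS : Fin N → Fin N → ℕ
        χS g c = indicator S (g ⊕ c)
        χCS : Fin N → Fin N → ℕ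
        χCS g c = χC c * χS g c
        count : ∀ g → isEven g * sum (χCS g) ≡ isEven g
        count g = trans (cong (isEven g *_) (isTPC⇒neighbour-count sf tpc g)) (*-identityʳ _)
        regroup : ∀ g c → isEven g * (χC c * χS g c) ≡ χC c * isOdd c * χS g c
        regroup g c = begin
          isEven g * (χC c * χS g c)   ≡⟨ x∙yz≈y∙xz (isEven g) (χC c) (χS g c) ⟩
          χC c * (isEven g * χS g c)   ≡⟨ cong (χC c *_) (isOdd-weight g c) ⟨
          χC c * (isOdd c * χS g c)    ≡⟨ *-assoc (χC c) _ _ ⟨
          χC c * isOdd c * χS g c      ∎

      isTPC⇒p≡2 : SquareFree S → ∀ {p} → Prime p → N ≡ p * ∣ S ∣ → HasTPC S → p ≡ 2
      isTPC⇒p≡2 sf {p} p-prime N≡p∣S∣ (C , tpc) = even-prime≡2 p-prime (divides K p≡K*2)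
        where
        K : ℕ
        K = sum (λ c → indicator C c * isOdd c)
        p≡K*2 : p ≡ K * 2
        p≡K*2 = *-cancelʳ-≡ p (K * 2) ∣ S ∣ {{≢-nonZero (factor≢0 {p} N≡p∣S∣)}} (begin
          p * ∣ S ∣          ≡⟨ N≡p∣S∣ ⟨
          N                  ≡⟨ N≡2*sum-isEven ⟩
          2 * sum isEven     ≡⟨ cong (2 *_) (isTPC⇒sum-isEven sf tpc) ⟩
          2 * (K * ∣ S ∣)    ≡⟨ *-assoc 2 K ∣ S ∣ ⟨
          2 * K * ∣ S ∣      ≡⟨ cong (_* ∣ S ∣) (*-comm 2 K) ⟩
          K * 2 * ∣ S ∣      ∎)
          where open ≡-Reasoning

      half-size⇒odd⇒∈S : N ≡ 2 * ∣ S ∣ → ∀ x → parity x ≡ 1F → x ∈ S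
      half-size⇒odd⇒∈S N≡2∣S∣ x px≡1 =
        sum≤∣p∣⇒support⊆p S isOdd χS≤isOdd (≤-reflexive sum-isOdd≡∣S∣) x
          (subst (λ b → 0 < toℕ b) (sym px≡1) (s≤s z≤n))
        where
        sum-isOdd≡∣S∣ : sum isOdd ≡ ∣ S ∣
        sum-isOdd≡∣S∣ = trans sum-isOdd≡sum-isEven (sym (N≡2*n⇒n≡sum-isEven N≡2∣S∣))
        χS≤isOdd : ∀ y → indicator S y ≤ isOdd y
        χS≤isOdd y with y ∈? S
        ... | yes y∈S = subst₂ _≤_ (sym (indicator-∈ y∈S)) (cong toℕ (sym (S-odd y∈S))) ≤-refl
        ... | no y∉S = subst (_≤ isOdd y) (sym (indicator-∉ y∉S)) z≤n

    module ParityClass {X : Subset N} {b : Fin 2} (X-class : ∀ x → x ∈ X ⇔ parity x ≡ b) where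

      inTranslate⇔ : ∀ g y → InTranslate X g y ⇔ parity y ≡ b ⊕ parity g
      inTranslate⇔ g y = mk⇔ in⇒ ⇒in
        where
        in⇒ : InTranslate X g y → parity y ≡ b ⊕ parity g
        in⇒ (x , x∈X , refl) = trans (parity-⊕ x g) (cong (_⊕ parity g) (to (X-class x) x∈X))
        ⇒in : parity y ≡ b ⊕ parity g → InTranslate X g y
        ⇒in py = y ⊖ g , from (X-class (y ⊖ g)) py⊖g , sym (⊖-⊕-cancel y g)
          where
          py⊖g : parity (y ⊖ g) ≡ b
          py⊖g = trans (parity-⊖ y g) (trans (cong (_⊕ parity g) py) (⊕₂-cancelʳ b (parity g)))

    ParityTransversal : Subset N → Set
    ParityTransversal C =
      Σ[ r ∈ (Fin 2 → Fin N) ] (∀ b → parity (r b) ≡ b) × (∀ x → x ∈ C ⇔ x ≡ r (parity x))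

    ≡-either⇔≡-at-parity : (r : Fin 2 → Fin N) → (∀ b → parity (r b) ≡ b)
      → ∀ x → (x ≡ r 0F ⊎ x ≡ r 1F) ⇔ x ≡ r (parity x)
    ≡-either⇔≡-at-parity r section x = mk⇔ (either⇒at x) (at⇒either x)
      where
      either⇒at : ∀ x → x ≡ r 0F ⊎ x ≡ r 1F → x ≡ r (parity x)
      either⇒at _ (inj₁ refl) = cong r (sym (section 0F))
      either⇒at _ (inj₂ refl) = cong r (sym (section 1F))
      at⇒either : ∀ x → x ≡ r (parity x) → x ≡ r 0F ⊎ x ≡ r 1F
      at⇒either x x≡r with parity x
      ... | 0F = inj₁ x≡r
      ... | 1F = inj₂ x≡r

    pair⇒transversal : ∀ {C} e o → parity e ≡ 0F → parity o ≡ 1F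
      → (∀ x → x ∈ C ⇔ (x ≡ e ⊎ x ≡ o)) → ParityTransversal C
    pair⇒transversal e o pe po mem =
      r , section , λ x → ⇔-trans (mem x) (≡-either⇔≡-at-parity r section x)
      where
      r : Fin 2 → Fin N
      r 0F = e
      r 1F = o
      section : ∀ b → parity (r b) ≡ b
      section 0F = pe
      section 1F = po

    transversal-exists : Σ (Subset N) ParityTransversal
    transversal-exists =
      C , pair⇒transversal (vertex 0F) (vertex 1F) (parity-vertex 0F) (parity-vertex 1F) mem
      where
      C : Subset N
      C = ⁅ vertex 0F ⁆ ∪ ⁅ vertex 1F ⁆
      mem : ∀ x → x ∈ C ⇔ (x ≡ vertex 0F ⊎ x ≡ vertex 1F)
      mem x = ⇔-trans ∪⇔⊎
        (mk⇔ (map (to x∈⁅y⁆⇔x≡y) (to x∈⁅y⁆⇔x≡y)) (map (from x∈⁅y⁆⇔x≡y) (from x∈⁅y⁆⇔x≡y)))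

    module Odds {S : Subset N} (S-odds : ∀ x → x ∈ S ⇔ parity x ≡ 1F) where

      open ParityClass S-odds using (inTranslate⇔)

      adjacent⇔opposite-parity : ∀ g c → Adj S g c ⇔ parity c ≡ parity g ⊕ 1F
      adjacent⇔opposite-parity g c = mk⇔
        (λ (g⊕c∈S , _) → to ⊕₂≡1 (trans (sym (parity-⊕ g c)) (to (S-odds _) g⊕c∈S)))
        (λ pc → from (S-odds _) (trans (parity-⊕ g c) (from ⊕₂≡1 pc))
              , λ g≡c → b≢b⊕1 (parity g) (trans (cong parity g≡c) pc))
        where
        ⊕₂≡1 : parity g ⊕ parity c ≡ 1F ⇔ parity c ≡ parity g ⊕ 1F
        ⊕₂≡1 = ⊕₂≡1⇔ (parity g) (parity c)

      isPeriod⇔even : ∀ g → IsPeriod S g ⇔ parity g ≡ 0F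
      isPeriod⇔even g = mk⇔ period⇒even even⇒period
        where
        period⇒even : IsPeriod S g → parity g ≡ 0F
        period⇒even period = 1≡1⊕b⇒b≡0 (parity g) (begin
          1F                  ≡⟨ parity-vertex 1F ⟨
          parity (vertex 1F)  ≡⟨ to (inTranslate⇔ g (vertex 1F)) (from (period _) odd∈S) ⟩
          1F ⊕ parity g       ∎)
          where
          open ≡-Reasoning
          odd∈S : vertex 1F ∈ S
          odd∈S = from (S-odds _) (parity-vertex 1F)
        even⇒period : parity g ≡ 0F → IsPeriod S g
        even⇒period pg y = ⇔-trans (inTranslate⇔ g y)
          (subst (λ t → (parity y ≡ 1F ⊕ t) ⇔ y ∈ S) (sym pg) (⇔-sym (S-odds y)))

      isTPC⇔transversal : ∀ C → IsTPC S C ⇔ ParityTransversal C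
      isTPC⇔transversal C = mk⇔ tpc⇒transversal transversal⇒tpc
        where
        transversal⇒tpc : ParityTransversal C → IsTPC S C
        transversal⇒tpc (r , section , mem) g =
          r (parity g ⊕ 1F) , from (mem _) (cong r (sym (section _)))
          , from (adjacent⇔opposite-parity g _) (section _) , unique
          where
          unique : ∀ c → c ∈ C → Adj S g c → c ≡ r (parity g ⊕ 1F)
          unique c c∈C adj = trans (to (mem c) c∈C) (cong r (to (adjacent⇔opposite-parity g c) adj))
        tpc⇒transversal : IsTPC S C → ParityTransversal C
        tpc⇒transversal tpc = r , section , mem
          where
          v : Fin 2 → Fin N
          v b = vertex (b ⊕ 1F)
          parity-v : ∀ b → parity (v b) ⊕ 1F ≡ b
          parity-v b = trans (cong (_⊕ 1F) (parity-vertex (b ⊕ 1F))) (⊕₂-cancelʳ b 1F)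
          r : Fin 2 → Fin N
          r b = proj₁ (tpc (v b))
          r∈C : ∀ b → r b ∈ C
          r∈C b = proj₁ (proj₂ (tpc (v b)))
          adjacent : ∀ b → Adj S (v b) (r b)
          adjacent b = proj₁ (proj₂ (proj₂ (tpc (v b))))
          unique : ∀ b c → c ∈ C → Adj S (v b) c → c ≡ r b
          unique b = proj₂ (proj₂ (proj₂ (tpc (v b))))
          section : ∀ b → parity (r b) ≡ b
          section b = trans (to (adjacent⇔opposite-parity (v b) (r b)) (adjacent b)) (parity-v b)
          mem : ∀ x → x ∈ C ⇔ x ≡ r (parity x)
          mem x = mk⇔
            (λ x∈C → unique (parity x) x x∈C
                       (from (adjacent⇔opposite-parity (v (parity x)) x) (sym (parity-v (parity x)))))
            (λ x≡r → subst (_∈ C) (sym x≡r) (r∈C (parity x)))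

    module Evens {H : Subset N} (H-evens : ∀ x → x ∈ H ⇔ parity x ≡ 0F) where

      open ParityClass H-evens using (inTranslate⇔)

      sameCoset-if-same-parity : ∀ {s s'} → parity s ≡ parity s' → SameCoset H s s'
      sameCoset-if-same-parity {s} {s'} ps≡ps' y = ⇔-trans (inTranslate⇔ s y)
        (subst (λ b → (parity y ≡ 0F ⊕ b) ⇔ InTranslate H s' y) (sym ps≡ps') (⇔-sym (inTranslate⇔ s' y)))

      -- S lies in a single coset of H, so the condition holds vacuously for every k.
      cosetCondition : ∀ {S : Subset N} → (∀ {x} → x ∈ S → parity x ≡ 1F)
        → ∀ k → CosetCondition S H k
      cosetCondition S-odd k s s' s∈S s'∈S ¬same _ =
        ¬same (sameCoset-if-same-parity (trans (S-odd s∈S) (sym (S-odd s'∈S))))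

      ∣H∣≡sum-isEven : ∣ H ∣ ≡ sum isEven
      ∣H∣≡sum-isEven = trans (∣p∣≡sum-indicator H) (sum-cong-≗ indicator≡isEven)
        where
        indicator≡isEven : ∀ x → indicator H x ≡ isEven x
        indicator≡isEven x with parity x in px
        ... | 0F = indicator-∈ (from (H-evens x) px)
        ... | 1F = indicator-∉ (λ x∈H → contradiction (trans (sym (to (H-evens x) x∈H)) px) λ ())

      index≡1 : ∀ {S : Subset N} {k} → N ≡ 2 * ∣ S ∣ → ∣ S ∣ ≡ k * ∣ H ∣ → k ≡ 1
      index≡1 {S} {k} N≡2∣S∣ ∣S∣≡k∣H∣ =
        *-cancelʳ-≡ k 1 ∣ H ∣ {{≢-nonZero (factor≢0 {2} N≡2∣H∣)}}
          (trans (sym ∣S∣≡k∣H∣) (trans ∣S∣≡∣H∣ (sym (*-identityˡ ∣ H ∣))))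
        where
        ∣S∣≡∣H∣ : ∣ S ∣ ≡ ∣ H ∣
        ∣S∣≡∣H∣ = trans (N≡2*n⇒n≡sum-isEven N≡2∣S∣) (sym ∣H∣≡sum-isEven)
        N≡2∣H∣ : N ≡ 2 * ∣ H ∣
        N≡2∣H∣ = trans N≡2∣S∣ (cong (2 *_) ∣S∣≡∣H∣)

      parity-even⊕ℕ : ∀ {h} → h ∈ H → ∀ i → parity (h ⊕ℕ i) ≡ i mod 2
      parity-even⊕ℕ {h} h∈H i =
        trans (parity-⊕ℕ h i) (trans (cong (_⊕ (i mod 2)) (to (H-evens h) h∈H)) (⊕₂-identityˡ (i mod 2)))

      generalForm⇔transversal : ∀ C → GeneralForm H 1 C ⇔ ParityTransversal C
      generalForm⇔transversal C = mk⇔ form⇒transversal transversal⇒form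
        where
        form⇒transversal : GeneralForm H 1 C → ParityTransversal C
        form⇒transversal (h₁ , h₂ , 0 , h₁∈H , h₂∈H , _ , mem) =
          pair⇒transversal (h₁ ⊕ℕ 0) (h₂ ⊕ℕ 1) (parity-even⊕ℕ h₁∈H 0) (parity-even⊕ℕ h₂∈H 1) mem
        form⇒transversal (h₁ , h₂ , 1 , h₁∈H , h₂∈H , _ , mem) =
          pair⇒transversal (h₂ ⊕ℕ 2) (h₁ ⊕ℕ 1) (parity-even⊕ℕ h₂∈H 2) (parity-even⊕ℕ h₁∈H 1)
            (λ x → ⇔-trans (mem x) (mk⇔ swap swap))
        form⇒transversal (_ , _ , suc (suc _) , _ , _ , s≤s () , _)
        transversal⇒form : ParityTransversal C → GeneralForm H 1 C
        transversal⇒form (r , section , mem) =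
          r 0F , r 1F ⊖ vertex 1F , 0 , from (H-evens _) (section 0F) , from (H-evens _) odd⊖odd
          , z≤n , mem′
          where
          odd⊖odd : parity (r 1F ⊖ vertex 1F) ≡ 0F
          odd⊖odd = trans (parity-⊖ (r 1F) (vertex 1F)) (cong₂ _⊕_ (section 1F) (parity-vertex 1F))
          mem′ : ∀ x → x ∈ C ⇔ (x ≡ r 0F ⊕ℕ 0 ⊎ x ≡ (r 1F ⊖ vertex 1F) ⊕ℕ 1)
          mem′ x = subst₂ (λ e o → x ∈ C ⇔ (x ≡ e ⊎ x ≡ o))
            (sym (⊕ℕ-identityʳ (r 0F)))
            (sym (trans (⊕ℕ-as-⊕ (r 1F ⊖ vertex 1F) 1) (⊖-⊕-cancel (r 1F) (vertex 1F))))
            (⇔-trans (mem x) (⇔-sym (≡-either⇔≡-at-parity r section x)))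

theorem3p4 : (n : ℕ) → 4 ≤ n → (S : Subset n) → SquareFree S
    → (p : ℕ) → Prime p → n ≡ p * ∣ S ∣ → Connected S
    → (H : Subset n) → ((g : Fin n) → (g ∈ H ⇔ IsPeriod S g))
    → (k : ℕ) → ∣ S ∣ ≡ k * ∣ H ∣
    → (HasTPC S ⇔ (p ≡ 2 × CosetCondition S H k))
      × ((p ≡ 2 × CosetCondition S H k)
         → (C : Subset n) → (IsTPC S C ⇔ GeneralForm H k C))
theorem3p4 (suc m) _ S sf p p-prime N≡p∣S∣ _ H H-periods k ∣S∣≡k∣H∣ =
  mk⇔ tpc⇒ ⇒tpc , classification
  where
  open Cyclic m
  open Even (squareFree⇒modulus-even sf (proj₂ (∣p∣≢0⇒nonempty S (factor≢0 {p} N≡p∣S∣))))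
  open SubsetOfOdds (squareFree⇒odd sf)

  module _ (p≡2 : p ≡ 2) where
    N≡2∣S∣ : N ≡ 2 * ∣ S ∣
    N≡2∣S∣ = trans N≡p∣S∣ (cong (_* ∣ S ∣) p≡2)
    open Odds (λ x → mk⇔ (squareFree⇒odd sf) (half-size⇒odd⇒∈S N≡2∣S∣ x)) public
    open Evens (λ x → ⇔-trans (H-periods x) (isPeriod⇔even x)) public
    k≡1 : k ≡ 1
    k≡1 = index≡1 {S} N≡2∣S∣ ∣S∣≡k∣H∣

  tpc⇒ : HasTPC S → p ≡ 2 × CosetCondition S H k
  tpc⇒ tpc = p≡2 , cosetCondition p≡2 (squareFree⇒odd sf) k
    where
    p≡2 : p ≡ 2
    p≡2 = isTPC⇒p≡2 sf p-prime N≡p∣S∣ tpc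

  ⇒tpc : p ≡ 2 × CosetCondition S H k → HasTPC S
  ⇒tpc (p≡2 , _) = proj₁ transversal-exists , from (isTPC⇔transversal p≡2 _) (proj₂ transversal-exists)

  classification : p ≡ 2 × CosetCondition S H k → (C : Subset N) → IsTPC S C ⇔ GeneralForm H k C
  classification (p≡2 , _) C = subst (λ k → IsTPC S C ⇔ GeneralForm H k C) (sym (k≡1 p≡2))
    (⇔-trans (isTPC⇔transversal p≡2 C) (⇔-sym (generalForm⇔transversal p≡2 C)))
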